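{- Suppose $\mathcal{B}$ is a Boolean algebra that is embeddable into the Medvedev lattice as a lattice, i.e. there is an injective map from $\mathcal{B}$ into the Medvedev degrees preserving binary meets and joins. Then $\mathcal{B}$ is countable.
   Context: A mass problem is a subset of $\omega^\omega$. $\mathcal{A}\leq_M\mathcal{B}$ means there is a partial computable functional $\Psi$ defined on all of $\mathcal{B}$ with $\Psi(\mathcal{B})\subseteq\mathcal{A}$; the Medvedev lattice consists of the $\equiv_M$-classes of mass problems, with join induced by $\mathcal{A}+\mathcal{B}=\{f\oplus g:f\in\mathcal{A},g\in\mathcal{B}\}$ (where $(f\oplus g)(2x)=f(x)$, $(f\oplus g)(2x+1)=g(x)$) and meet induced by $\mathcal{A}\times\mathcal{B}=\{0\,\widehat{\ }\,f:f\in\mathcal{A}\}\cup\{1\,\widehat{\ }\,g:g\in\mathcal{B}\}$. -}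

module Defs where

open import Level using (Level; _⊔_) renaming (zero to lzero)
open import Data.Nat using (ℕ; zero; suc; _/_; _%_)
open import Data.Fin using (Fin)
open import Data.Vec using (Vec; []; _∷_; lookup)
open import Data.Maybe using (Maybe; just; nothing)
open import Data.Sum using (_⊎_)
open import Data.Product using (Σ; ∃; _×_; _,_)
open import Relation.Binary.PropositionalEquality using (_≡_)
open import Relation.Unary using (Pred)
open import Algebra.Lattice.Bundles using (BooleanAlgebra)

-- Oracle computation model: Kleene's partial recursive functions
-- relative to a total oracle f : ℕ → ℕ.  A term of type `PR n` is an
-- n-ary partial recursive function with oracle.

data PR : ℕ → Set where
  zer  : ∀ {n} → PR n
  sc   : PR 1
  prj  : ∀ {n} → Fin n → PR n
  orc  : PR 1
  comp : ∀ {n m} → PR m → Vec (PR n) m → PR n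
  rec  : ∀ {n} → PR n → PR (suc (suc n)) → PR (suc n)
  mu   : ∀ {n} → PR (suc n) → PR n

-- Fuel-indexed evaluator.  `eval k p f xs ≡ just y` means the computation
-- of p with oracle f on input xs halts with output y within fuel k.
mutual
  eval : ℕ → ∀ {n} → PR n → (ℕ → ℕ) → Vec ℕ n → Maybe ℕ
  eval zero    _          _ _  = nothing
  eval (suc k) zer        f xs = just 0
  eval (suc k) sc         f (x ∷ []) = just (suc x)
  eval (suc k) (prj i)    f xs = just (lookup xs i)
  eval (suc k) orc        f (x ∷ []) = just (f x)
  eval (suc k) (comp p qs) f xs with evalVec k qs f xs
  ... | nothing = nothing
  ... | just ys = eval k p f ys
  eval (suc k) (rec p q)  f (y ∷ xs) = evalRec k p q f y xs
  eval (suc k) (mu p)     f xs = search k p f 0 xs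

  evalVec : ℕ → ∀ {n m} → Vec (PR n) m → (ℕ → ℕ) → Vec ℕ n → Maybe (Vec ℕ m)
  evalVec k []       f xs = just []
  evalVec k (q ∷ qs) f xs with eval k q f xs | evalVec k qs f xs
  ... | just y | just ys = just (y ∷ ys)
  ... | _      | _       = nothing

  evalRec : ℕ → ∀ {n} → PR n → PR (suc (suc n)) → (ℕ → ℕ) → ℕ → Vec ℕ n → Maybe ℕ
  evalRec k p q f zero    xs = eval k p f xs
  evalRec k p q f (suc y) xs with evalRec k p q f y xs
  ... | nothing = nothing
  ... | just r  = eval k q f (y ∷ r ∷ xs)

  search : ℕ → ∀ {n} → PR (suc n) → (ℕ → ℕ) → ℕ → Vec ℕ n → Maybe ℕ
  search zero    p f i xs = nothing
  search (suc k) p f i xs with eval k p f (i ∷ xs)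
  ... | nothing      = nothing
  ... | just zero    = just i
  ... | just (suc _) = search k p f (suc i) xs

-- The partial computable functional Ψ with index e : PR 1 maps f to the
-- function x ↦ Φ_e^f(x).  `Computes e f h` : Ψ_e(f) is total and equals h.
Computes : PR 1 → (ℕ → ℕ) → (ℕ → ℕ) → Set
Computes e f h = ∀ x → ∃ λ k → eval k e f (x ∷ []) ≡ just (h x)

MassProblem : Set₁
MassProblem = Pred (ℕ → ℕ) lzero

_≤M_ : MassProblem → MassProblem → Set
A ≤M B = Σ (PR 1) λ e → ∀ g → B g → Σ (ℕ → ℕ) λ h → Computes e g h × A h

_≡M_ : MassProblem → MassProblem → Set
A ≡M B = (A ≤M B) × (B ≤M A)

_⊕_ : (ℕ → ℕ) → (ℕ → ℕ) → (ℕ → ℕ)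
(f ⊕ g) n with n % 2
... | zero  = f (n / 2)
... | suc _ = g (n / 2)

cons : ℕ → (ℕ → ℕ) → (ℕ → ℕ)
cons i f zero    = i
cons i f (suc x) = f x

_+M_ : MassProblem → MassProblem → MassProblem
(A +M B) h = Σ (ℕ → ℕ) λ f → Σ (ℕ → ℕ) λ g → A f × B g × (h ≡ (f ⊕ g))

_×M_ : MassProblem → MassProblem → MassProblem
(A ×M B) h = (Σ (ℕ → ℕ) λ f → A f × (h ≡ cons 0 f))
           ⊎ (Σ (ℕ → ℕ) λ g → B g × (h ≡ cons 1 g))

-- Lattice embeddings of a Boolean algebra into the Medvedev lattice.
-- A map into the Medvedev degrees is represented by a map into mass
-- problems that respects the algebra's equality up to ≡M.

record MedvedevLatticeEmbedding {c ℓ : Level} (𝔹 : BooleanAlgebra c ℓ) : Set (c ⊔ ℓ ⊔ Level.suc lzero) where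
  open BooleanAlgebra 𝔹
  field
    φ          : Carrier → MassProblem
    φ-cong     : ∀ {a b} → a ≈ b → φ a ≡M φ b
    φ-injective : ∀ {a b} → φ a ≡M φ b → a ≈ b
    φ-join     : ∀ a b → φ (a ∨ b) ≡M (φ a +M φ b)
    φ-meet     : ∀ a b → φ (a ∧ b) ≡M (φ a ×M φ b)

Countable : {c ℓ : Level} → BooleanAlgebra c ℓ → Set (c ⊔ ℓ)
Countable 𝔹 = Σ (Carrier → ℕ) λ g → ∀ a b → g a ≡ g b → a ≈ b
  where open BooleanAlgebra 𝔹

-- There are only countably many programs, and a ↦ e_a is injective, where e_a indexes a reduction of
-- φ(a) × φ(¬a) to φ(⊥) ≡M φ(a ∧ ¬a). Indeed, if e_a = e_b then for g ∈ φ(⊥) the first value of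
-- Ψ_{e_a}(g) decides at once whether Ψ_{e_a}(g) ∈ 0⌢φ(a) or Ψ_{e_b}(g) ∈ 1⌢φ(¬b), so the same functional
-- reduces φ(a) × φ(¬b) ≡M φ(a ∧ ¬b) to φ(⊥). As φ(⊥) is least in the image, injectivity of φ gives
-- a ∧ ¬b = ⊥; symmetrically b ∧ ¬a = ⊥, hence a = b.
module Submission where

open import Defs
open import Level using (Level)
open import Algebra.Lattice.Bundles using (BooleanAlgebra)
import Algebra.Lattice.Properties.BooleanAlgebra as BooleanAlgebraProperties
open import Data.Nat using (ℕ; zero; suc; _≤_; _≤′_; ≤′-refl; ≤′-step; _⊔_)
open import Data.Nat.Properties using (≤⇒≤′; m≤m⊔n; m≤n⊔m; suc-injective)
open import Data.Nat.Binary using (ℕᵇ; 2[1+_]; 1+[2_])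
import Data.Nat.Binary as ℕᵇ
open import Data.Nat.Binary.Properties using (2[1+_]-injective; 1+[2_]-injective)
import Data.Nat.Binary.Properties as ℕᵇ
open import Data.Fin as Fin using (Fin; toℕ)
open import Data.Vec using (Vec; []; _∷_)
open import Data.List using (List; []; _∷_; length)
open import Data.Maybe as Maybe using (Maybe; just; nothing; zipWith)
open import Data.Maybe.Properties using (just-injective)
open import Data.Sum using (inj₁; inj₂)
open import Data.Product using (Σ; ∃; _×_; _,_; proj₁; proj₂; map)
open import Function using (id)
open import Relation.Binary.PropositionalEquality using (_≡_; refl; trans; cong; cong-app; subst)
import Relation.Binary.PropositionalEquality as ≡
import Relation.Binary.Reasoning.Setoid as SetoidReasoning

_⇓_ : {A : Set} → (ℕ → Maybe A) → A → Set
F ⇓ a = ∃ λ k → F k ≡ just a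

FuelMonotone : {A : Set} → (ℕ → Maybe A) → Set
FuelMonotone F = ∀ k {a} → F k ≡ just a → F (suc k) ≡ just a

module _ {A : Set} {F : ℕ → Maybe A} (F-mono : FuelMonotone F) where

  fuel-≤ : ∀ {j k a} → j ≤ k → F j ≡ just a → F k ≡ just a
  fuel-≤ {j} j≤k Fj = go (≤⇒≤′ j≤k)
    where
    go : ∀ {k} → j ≤′ k → F k ≡ just _
    go ≤′-refl        = Fj
    go (≤′-step j≤′k) = F-mono _ (go j≤′k)

  ⇓-functional : ∀ {a b} → F ⇓ a → F ⇓ b → a ≡ b
  ⇓-functional (j , Fj) (k , Fk) =
    just-injective (trans (≡.sym (fuel-≤ (m≤m⊔n j k) Fj)) (fuel-≤ (m≤n⊔m j k) Fk))

⇓-together : ∀ {A B : Set} {F : ℕ → Maybe A} {G : ℕ → Maybe B} {a b} →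
             FuelMonotone F → FuelMonotone G → F ⇓ a → G ⇓ b →
             ∃ λ k → F k ≡ just a × G k ≡ just b
⇓-together F-mono G-mono (j , Fj) (k , Gk) =
  j ⊔ k , fuel-≤ F-mono (m≤m⊔n j k) Fj , fuel-≤ G-mono (m≤n⊔m j k) Gk

eval-comp : ∀ k {n m} (p : PR m) (qs : Vec (PR n) m) {f xs ys} →
            evalVec k qs f xs ≡ just ys → eval (suc k) (comp p qs) f xs ≡ eval k p f ys
eval-comp k p qs qs⇓ rewrite qs⇓ = refl

evalVec-∷ : ∀ k {n m} (q : PR n) (qs : Vec (PR n) m) {f xs y ys} →
            eval k q f xs ≡ just y → evalVec k qs f xs ≡ just ys →
            evalVec k (q ∷ qs) f xs ≡ just (y ∷ ys)
evalVec-∷ k q qs q⇓ qs⇓ rewrite q⇓ | qs⇓ = refl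

evalRec-suc : ∀ k {n} (p : PR n) q y {f xs r} →
              evalRec k p q f y xs ≡ just r → evalRec k p q f (suc y) xs ≡ eval k q f (y ∷ r ∷ xs)
evalRec-suc k p q y y⇓ rewrite y⇓ = refl

search-found : ∀ k {n} (p : PR (suc n)) {f i xs} →
               eval k p f (i ∷ xs) ≡ just 0 → search (suc k) p f i xs ≡ just i
search-found k p i⇓ rewrite i⇓ = refl

search-next : ∀ k {n} (p : PR (suc n)) {f i xs z} →
              eval k p f (i ∷ xs) ≡ just (suc z) → search (suc k) p f i xs ≡ search k p f (suc i) xs
search-next k p i⇓ rewrite i⇓ = refl

mutual
  eval-mono : ∀ {n} (p : PR n) f xs → FuelMonotone (λ k → eval k p f xs)
  eval-mono p           f xs       zero    ()
  eval-mono zer         f xs       (suc k) halts = halts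
  eval-mono sc          f (x ∷ []) (suc k) halts = halts
  eval-mono (prj i)     f xs       (suc k) halts = halts
  eval-mono orc         f (x ∷ []) (suc k) halts = halts
  eval-mono (comp p qs) f xs       (suc k) halts with evalVec k qs f xs in qs⇓
  ... | just ys = trans (eval-comp (suc k) p qs (evalVec-mono qs f xs k qs⇓)) (eval-mono p f ys k halts)
  eval-mono (rec p q)   f (y ∷ xs) (suc k) halts = evalRec-mono p q f y xs k halts
  eval-mono (mu p)      f xs       (suc k) halts = search-mono p f 0 xs k halts

  evalVec-mono : ∀ {n m} (qs : Vec (PR n) m) f xs → FuelMonotone (λ k → evalVec k qs f xs)
  evalVec-mono []       f xs k halts = halts
  evalVec-mono (q ∷ qs) f xs k halts with eval k q f xs in q⇓ | evalVec k qs f xs in qs⇓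
  evalVec-mono (q ∷ qs) f xs k refl | just _ | just _ =
    evalVec-∷ (suc k) q qs (eval-mono q f xs k q⇓) (evalVec-mono qs f xs k qs⇓)

  evalRec-mono : ∀ {n} (p : PR n) q f y xs → FuelMonotone (λ k → evalRec k p q f y xs)
  evalRec-mono p q f zero    xs k halts = eval-mono p f xs k halts
  evalRec-mono p q f (suc y) xs k halts with evalRec k p q f y xs in y⇓
  ... | just r = trans (evalRec-suc (suc k) p q y (evalRec-mono p q f y xs k y⇓))
                       (eval-mono q f (y ∷ r ∷ xs) k halts)

  search-mono : ∀ {n} (p : PR (suc n)) f i xs → FuelMonotone (λ k → search k p f i xs)
  search-mono p f i xs zero    ()
  search-mono p f i xs (suc k) halts with eval k p f (i ∷ xs) in i⇓
  search-mono p f i xs (suc k) refl | just zero = search-found (suc k) p (eval-mono p f (i ∷ xs) k i⇓)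
  ... | just (suc _) = trans (search-next (suc k) p (eval-mono p f (i ∷ xs) k i⇓))
                             (search-mono p f (suc i) xs k halts)

computes-functional : ∀ {e f h₁ h₂} → Computes e f h₁ → Computes e f h₂ → ∀ x → h₁ x ≡ h₂ x
computes-functional {e} {f} c₁ c₂ x = ⇓-functional (eval-mono e f (x ∷ [])) (c₁ x) (c₂ x)

mutual
  _[orc≔_] : ∀ {n} → PR n → PR 1 → PR n
  zer       [orc≔ e ] = zer
  sc        [orc≔ e ] = sc
  prj i     [orc≔ e ] = prj i
  orc       [orc≔ e ] = e
  comp p qs [orc≔ e ] = comp (p [orc≔ e ]) (qs [orcs≔ e ])
  rec p q   [orc≔ e ] = rec (p [orc≔ e ]) (q [orc≔ e ])
  mu p      [orc≔ e ] = mu (p [orc≔ e ])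

  _[orcs≔_] : ∀ {n m} → Vec (PR n) m → PR 1 → Vec (PR n) m
  []       [orcs≔ e ] = []
  (q ∷ qs) [orcs≔ e ] = q [orc≔ e ] ∷ qs [orcs≔ e ]

module _ {e : PR 1} {g h : ℕ → ℕ} (e-computes : Computes e g h) where

  mutual
    eval-[orc≔] : ∀ k {n} (p : PR n) {xs y} → eval k p h xs ≡ just y →
                  (λ j → eval j (p [orc≔ e ]) g xs) ⇓ y
    eval-[orc≔] zero    p           ()
    eval-[orc≔] (suc k) zer         refl = 1 , refl
    eval-[orc≔] (suc k) sc {x ∷ []} refl = 1 , refl
    eval-[orc≔] (suc k) (prj i)     refl = 1 , refl
    eval-[orc≔] (suc k) orc {x ∷ []} refl = e-computes x
    eval-[orc≔] (suc k) (comp p qs) {xs} p⇓ with evalVec k qs h xs in qs⇓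
    ... | just ys with ⇓-together (evalVec-mono (qs [orcs≔ e ]) g xs) (eval-mono (p [orc≔ e ]) g ys)
                                  (evalVec-[orcs≔] k qs qs⇓) (eval-[orc≔] k p p⇓)
    ...   | j , qs⇓′ , p⇓′ = suc j , trans (eval-comp j (p [orc≔ e ]) (qs [orcs≔ e ]) qs⇓′) p⇓′
    eval-[orc≔] (suc k) (rec p q) {y ∷ xs} y⇓ = map suc id (evalRec-[orc≔] k p q y y⇓)
    eval-[orc≔] (suc k) (mu p) p⇓ = map suc id (search-[orc≔] k p p⇓)

    evalVec-[orcs≔] : ∀ k {n m} (qs : Vec (PR n) m) {xs ys} → evalVec k qs h xs ≡ just ys →
                      (λ j → evalVec j (qs [orcs≔ e ]) g xs) ⇓ ys
    evalVec-[orcs≔] k [] refl = 0 , refl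
    evalVec-[orcs≔] k (q ∷ qs) {xs} qs⇓ with eval k q h xs in q⇓ | evalVec k qs h xs in qs⇓
    evalVec-[orcs≔] k (q ∷ qs) {xs} refl | just y | just ys
      with ⇓-together (eval-mono (q [orc≔ e ]) g xs) (evalVec-mono (qs [orcs≔ e ]) g xs)
                      (eval-[orc≔] k q q⇓) (evalVec-[orcs≔] k qs qs⇓)
    ... | j , q⇓′ , qs⇓′ = j , evalVec-∷ j (q [orc≔ e ]) (qs [orcs≔ e ]) q⇓′ qs⇓′

    evalRec-[orc≔] : ∀ k {n} (p : PR n) q y {xs r} → evalRec k p q h y xs ≡ just r →
                     (λ j → evalRec j (p [orc≔ e ]) (q [orc≔ e ]) g y xs) ⇓ r
    evalRec-[orc≔] k p q zero    y⇓ = eval-[orc≔] k p y⇓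
    evalRec-[orc≔] k p q (suc y) {xs} y⇓ with evalRec k p q h y xs in y⇓₀
    ... | just r
      with ⇓-together (evalRec-mono (p [orc≔ e ]) (q [orc≔ e ]) g y xs)
                      (eval-mono (q [orc≔ e ]) g (y ∷ r ∷ xs))
                      (evalRec-[orc≔] k p q y y⇓₀) (eval-[orc≔] k q y⇓)
    ... | j , y⇓₀′ , y⇓′ = j , trans (evalRec-suc j (p [orc≔ e ]) (q [orc≔ e ]) y y⇓₀′) y⇓′

    search-[orc≔] : ∀ k {n} (p : PR (suc n)) {i xs r} → search k p h i xs ≡ just r →
                    (λ j → search j (p [orc≔ e ]) g i xs) ⇓ r
    search-[orc≔] zero    p ()
    search-[orc≔] (suc k) p {i} {xs} found with eval k p h (i ∷ xs) in i⇓
    search-[orc≔] (suc k) p refl | just zero =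
      let j , i⇓′ = eval-[orc≔] k p i⇓ in suc j , search-found j (p [orc≔ e ]) i⇓′
    search-[orc≔] (suc k) p {i} {xs} found | just (suc _)
      with ⇓-together (eval-mono (p [orc≔ e ]) g (i ∷ xs)) (search-mono (p [orc≔ e ]) g (suc i) xs)
                      (eval-[orc≔] k p i⇓) (search-[orc≔] k p found)
    ... | j , i⇓′ , found′ = suc j , trans (search-next j (p [orc≔ e ]) i⇓′) found′

computes-[orc≔] : ∀ {e₁ e₂ f g h} → Computes e₂ f g → Computes e₁ g h → Computes (e₁ [orc≔ e₂ ]) f h
computes-[orc≔] {e₁} e₂-computes e₁-computes x =
  let k , e₁⇓ = e₁-computes x in eval-[orc≔] e₂-computes k e₁ e₁⇓

-- Decoding is structurally recursive on trees, not on flat codes; hence the detour through trees.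
data Tree : Set where
  node : ℕ → List Tree → Tree

mutual
  toTree : ∀ {n} → PR n → Tree
  toTree zer                 = node 0 []
  toTree sc                  = node 1 []
  toTree (prj i)             = node 2 (node (toℕ i) [] ∷ [])
  toTree orc                 = node 3 []
  toTree (comp {m = m} p qs) = node 4 (node m [] ∷ toTree p ∷ toForest qs)
  toTree (rec p q)           = node 5 (toTree p ∷ toTree q ∷ [])
  toTree (mu p)              = node 6 (toTree p ∷ [])

  toForest : ∀ {n m} → Vec (PR n) m → List Tree
  toForest []       = []
  toForest (q ∷ qs) = toTree q ∷ toForest qs

fin? : ∀ n → ℕ → Maybe (Fin n)
fin? zero    _       = nothing
fin? (suc n) zero    = just Fin.zero
fin? (suc n) (suc i) = Maybe.map Fin.suc (fin? n i)

fin?-toℕ : ∀ {n} (i : Fin n) → fin? n (toℕ i) ≡ just i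
fin?-toℕ Fin.zero = refl
fin?-toℕ (Fin.suc i) rewrite fin?-toℕ i = refl

mutual
  fromTree : Tree → ∀ n → Maybe (PR n)
  fromTree (node 0 [])                    n       = just zer
  fromTree (node 1 [])                    1       = just sc
  fromTree (node 2 (node i [] ∷ []))      n       = Maybe.map prj (fin? n i)
  fromTree (node 3 [])                    1       = just orc
  fromTree (node 4 (node m [] ∷ t ∷ ts)) n       = zipWith comp (fromTree t m) (fromForest ts n m)
  fromTree (node 5 (t ∷ u ∷ []))          (suc n) = zipWith rec (fromTree t n) (fromTree u (suc (suc n)))
  fromTree (node 6 (t ∷ []))              n       = Maybe.map mu (fromTree t (suc n))
  fromTree _                              _       = nothing

  fromForest : List Tree → ∀ n m → Maybe (Vec (PR n) m)
  fromForest []       n zero    = just []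
  fromForest (t ∷ ts) n (suc m) = zipWith _∷_ (fromTree t n) (fromForest ts n m)
  fromForest _        _ _       = nothing

mutual
  fromTree-toTree : ∀ {n} (p : PR n) → fromTree (toTree p) n ≡ just p
  fromTree-toTree zer         = refl
  fromTree-toTree sc          = refl
  fromTree-toTree (prj i)     rewrite fin?-toℕ i = refl
  fromTree-toTree orc         = refl
  fromTree-toTree (comp p qs) rewrite fromTree-toTree p | fromForest-toForest qs = refl
  fromTree-toTree (rec p q)   rewrite fromTree-toTree p | fromTree-toTree q = refl
  fromTree-toTree (mu p)      rewrite fromTree-toTree p = refl

  fromForest-toForest : ∀ {n m} (qs : Vec (PR n) m) → fromForest (toForest qs) n m ≡ just qs
  fromForest-toForest []       = refl
  fromForest-toForest (q ∷ qs) rewrite fromTree-toTree q | fromForest-toForest qs = refl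

toTree-injective : ∀ {n} {p q : PR n} → toTree p ≡ toTree q → p ≡ q
toTree-injective {n} {p} {q} toTree≡ = just-injective (begin
  just p                ≡⟨ fromTree-toTree p ⟨
  fromTree (toTree p) n ≡⟨ cong (λ t → fromTree t n) toTree≡ ⟩
  fromTree (toTree q) n ≡⟨ fromTree-toTree q ⟩
  just q                ∎)
  where open ≡.≡-Reasoning

unary : ℕ → ℕᵇ → ℕᵇ
unary zero    r = 1+[2 r ]
unary (suc l) r = 2[1+ unary l r ]

unary-injective : ∀ l l′ {r r′} → unary l r ≡ unary l′ r′ → l ≡ l′ × r ≡ r′
unary-injective zero    zero     eq = refl , 1+[2_]-injective eq
unary-injective (suc l) (suc l′) eq with unary-injective l l′ (2[1+_]-injective eq)
... | refl , r≡r′ = refl , r≡r′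

mutual
  treeCode : Tree → ℕᵇ → ℕᵇ
  treeCode (node l ts) r = unary l (unary (length ts) (forestCode ts r))

  forestCode : List Tree → ℕᵇ → ℕᵇ
  forestCode []       r = r
  forestCode (t ∷ ts) r = treeCode t (forestCode ts r)

mutual
  treeCode-injective : ∀ t u {r s} → treeCode t r ≡ treeCode u s → t ≡ u × r ≡ s
  treeCode-injective (node l ts) (node l′ us) eq with unary-injective l l′ eq
  ... | refl , eq′ with unary-injective (length ts) (length us) eq′
  ... | length≡ , eq″ with forestCode-injective ts us length≡ eq″
  ... | refl , r≡s = refl , r≡s

  forestCode-injective : ∀ ts us {r s} → length ts ≡ length us →
                         forestCode ts r ≡ forestCode us s → ts ≡ us × r ≡ s
  forestCode-injective []       []       _       eq = refl , eq
  forestCode-injective (t ∷ ts) (u ∷ us) length≡ eq with treeCode-injective t u eq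
  ... | refl , eq′ with forestCode-injective ts us (suc-injective length≡) eq′
  ... | refl , r≡s = refl , r≡s

code : ∀ {n} → PR n → ℕ
code p = ℕᵇ.toℕ (treeCode (toTree p) ℕᵇ.zero)

code-injective : ∀ {n} {p q : PR n} → code p ≡ code q → p ≡ q
code-injective eq = toTree-injective (proj₁ (treeCode-injective _ _ (ℕᵇ.toℕ-injective eq)))

_≤M[_]_ : MassProblem → PR 1 → MassProblem → Set
A ≤M[ e ] B = ∀ g → B g → Σ (ℕ → ℕ) λ h → Computes e g h × A h

≤M-trans : ∀ {A B C} → A ≤M B → B ≤M C → A ≤M C
≤M-trans (e₁ , A≤B) (e₂ , B≤C) = e₁ [orc≔ e₂ ] , λ g Cg →
  let h , e₂-computes , Bh = B≤C g Cg
      a , e₁-computes , Aa = A≤B h Bh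
  in a , computes-[orc≔] e₂-computes e₁-computes , Aa

prepend0 : PR 1
prepend0 = rec zer (comp orc (prj Fin.zero ∷ []))

prepend0-computes : ∀ f → Computes prepend0 f (cons 0 f)
prepend0-computes f x = 4 , unfold x
  where
  unfold : ∀ x → evalRec 3 zer (comp orc (prj Fin.zero ∷ [])) f x [] ≡ just (cons 0 f x)
  unfold zero    = refl
  unfold (suc x) rewrite unfold x = refl

A×MB≤MA : ∀ {A B} → (A ×M B) ≤M A
A×MB≤MA = prepend0 , λ f Af → cons 0 f , prepend0-computes f , inj₁ (f , Af , refl)

×M-cross : ∀ {A A′ B B′ C e} → (A ×M A′) ≤M[ e ] C → (B ×M B′) ≤M[ e ] C → (A ×M B′) ≤M[ e ] C
×M-cross red₁ red₂ g Cg with red₁ g Cg | red₂ g Cg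
... | h , Ψg≡h , inj₁ Ah | _                  = h , Ψg≡h , inj₁ Ah
... | _                  | h , Ψg≡h , inj₂ B′h = h , Ψg≡h , inj₂ B′h
... | h₁ , Ψg≡h₁ , inj₂ (_ , _ , h₁≡1⌢) | h₂ , Ψg≡h₂ , inj₁ (_ , _ , h₂≡0⌢)
  with trans (≡.sym (cong-app h₁≡1⌢ 0)) (trans (computes-functional Ψg≡h₁ Ψg≡h₂ 0) (cong-app h₂≡0⌢ 0))
... | ()

module _ {c ℓ} (𝔹 : BooleanAlgebra c ℓ) where
  open BooleanAlgebra 𝔹
  open BooleanAlgebraProperties 𝔹 using (∧-identityʳ; ∨-identityʳ)
  open SetoidReasoning setoid

  ∧¬≈⊥⇒≈∧ : ∀ {a b} → a ∧ ¬ b ≈ ⊥ → a ≈ a ∧ b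
  ∧¬≈⊥⇒≈∧ {a} {b} a∧¬b≈⊥ = begin
    a                   ≈⟨ ∧-identityʳ a ⟨
    a ∧ ⊤               ≈⟨ ∧-congˡ (∨-complementʳ b) ⟨
    a ∧ (b ∨ ¬ b)       ≈⟨ ∧-distribˡ-∨ a b (¬ b) ⟩
    (a ∧ b) ∨ (a ∧ ¬ b) ≈⟨ ∨-congˡ a∧¬b≈⊥ ⟩
    (a ∧ b) ∨ ⊥         ≈⟨ ∨-identityʳ (a ∧ b) ⟩
    a ∧ b               ∎

  ∧¬≈⊥-antisym : ∀ {a b} → a ∧ ¬ b ≈ ⊥ → b ∧ ¬ a ≈ ⊥ → a ≈ b
  ∧¬≈⊥-antisym {a} {b} a∧¬b≈⊥ b∧¬a≈⊥ = begin
    a     ≈⟨ ∧¬≈⊥⇒≈∧ a∧¬b≈⊥ ⟩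
    a ∧ b ≈⟨ ∧-comm a b ⟩
    b ∧ a ≈⟨ ∧¬≈⊥⇒≈∧ b∧¬a≈⊥ ⟨
    b     ∎

module _ {c ℓ} {𝔹 : BooleanAlgebra c ℓ} (E : MedvedevLatticeEmbedding 𝔹) where
  open BooleanAlgebra 𝔹
  open BooleanAlgebraProperties 𝔹 using (∧-zeroʳ)
  open MedvedevLatticeEmbedding E

  φ⊥≤Mφ : ∀ a → φ ⊥ ≤M φ a
  φ⊥≤Mφ a = ≤M-trans (proj₁ (φ-cong (sym (∧-zeroʳ a))))
                     (≤M-trans (proj₁ (φ-meet a ⊥)) A×MB≤MA)

  φ×φ¬≤Mφ⊥ : ∀ a → (φ a ×M φ (¬ a)) ≤M φ ⊥
  φ×φ¬≤Mφ⊥ a = ≤M-trans (proj₂ (φ-meet a (¬ a))) (proj₁ (φ-cong (∧-complementʳ a)))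

  index : Carrier → PR 1
  index a = proj₁ (φ×φ¬≤Mφ⊥ a)

  index≡⇒∧¬≈⊥ : ∀ {a b} → index a ≡ index b → a ∧ ¬ b ≈ ⊥
  index≡⇒∧¬≈⊥ {a} {b} index≡ = φ-injective (φa∧¬b≤Mφ⊥ , φ⊥≤Mφ (a ∧ ¬ b))
    where
    φb×φ¬b≤M[index-a]φ⊥ : (φ b ×M φ (¬ b)) ≤M[ index a ] φ ⊥
    φb×φ¬b≤M[index-a]φ⊥ =
      subst (λ e → (φ b ×M φ (¬ b)) ≤M[ e ] φ ⊥) (≡.sym index≡) (proj₂ (φ×φ¬≤Mφ⊥ b))

    φa∧¬b≤Mφ⊥ : φ (a ∧ ¬ b) ≤M φ ⊥
    φa∧¬b≤Mφ⊥ = ≤M-trans (proj₁ (φ-meet a (¬ b)))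
                        (index a , ×M-cross (proj₂ (φ×φ¬≤Mφ⊥ a)) φb×φ¬b≤M[index-a]φ⊥)

  index-injective : ∀ {a b} → index a ≡ index b → a ≈ b
  index-injective index≡ = ∧¬≈⊥-antisym 𝔹 (index≡⇒∧¬≈⊥ index≡) (index≡⇒∧¬≈⊥ (≡.sym index≡))

theorem5p4 : {c ℓ : Level} (𝔹 : BooleanAlgebra c ℓ) → MedvedevLatticeEmbedding 𝔹 → Countable 𝔹
theorem5p4 𝔹 E = (λ a → code (index E a)) ,
                 λ a b code≡ → index-injective E (code-injective code≡)
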